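{- Let $n\ge 1$, $q\ge 2$, $m\ge 0$ be integers, and (if $m\ge 1$) let $M^1,\dots,M^q$ be a partition of the vertex set of $H(m,q)$ into $q$ pairwise disjoint distance-$2$ MDS codes; define the maps $G^i_t$ ($1\le i\le q$, $0\le t\le q$) as in the context. (1) Let $f$ be a perfect $(q+1)$-coloring of $H(n,q)$ with quotient matrix $(s_{ij})_{i,j=1}^{q+1}$ where $s_{ii}=\alpha'$ and $s_{ij}=\alpha$ for distinct $i,j\le q$, $s_{i,q+1}=\beta$ for $i\le q$, $s_{q+1,j}=\gamma$ for $j\le q$, and $s_{q+1,q+1}=\delta$. If $\gamma-\alpha=m\ge 0$, then for each $t\in\{0,\dots,q\}$ and $l\in\{1,2\}$ with $t(l-1)+(q-t)(2-l)\neq 0$, the invasion $h_l=f\times(G^1_t,\dots,G^q_t,\mathbf{l})$, where $\mathbf{l}$ is the constant map of $H(m,q)$ to color $l$, is a $(b_l,c_l)$-coloring of $H(n+m,q)$ with $b_l=\gamma(q-t)+\beta(l-1)$ and $c_l=\gamma t+\beta(2-l)$. (2) Let $f$ be a perfect $2q$-coloring of $H(n,q)$ with quotient matrix $(s_{ij})_{i,j=1}^{2q}$ where $s_{ij}=\alpha$ if $i,j\le q$, $s_{ij}=\beta$ if $i\le q<j$, $s_{ij}=\gamma$ if $j\le q<i$, $s_{ij}=\delta$ if $i,j>q$. If $\gamma-\alpha=\beta-\delta=m\ge 0$, then for all $t_1,t_2\in\{0,\dots,q\}$ with $t_1+t_2\notin\{0,2q\}$, the invasion $h=f\times(G^1_{t_1},\dots,G^q_{t_1},G^1_{t_2},\dots,G^q_{t_2})$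 is a $(b,c)$-coloring of $H(n+m,q)$ with $b=q(\gamma+\beta)-\gamma t_1-\beta t_2$ and $c=\gamma t_1+\beta t_2$.
   Context: $H(n,q)$: vertex set $\mathbb{Z}_q^n$, adjacency = Hamming distance $1$. A perfect $k$-coloring is a surjective map onto $\{1,\dots,k\}$ such that each vertex of color $i$ has exactly $s_{ij}$ neighbors of color $j$ (quotient matrix $(s_{ij})$). A $(b,c)$-coloring of $H(N,q)$ is a perfect $2$-coloring with quotient matrix $\begin{pmatrix} N(q-1)-b & b\\ c& N(q-1)-c\end{pmatrix}$. A distance-$2$ MDS code in $H(m,q)$ is a set of $q^{m-1}$ vertices with pairwise Hamming distance at least $2$. For a map $f$ from $\mathbb{Z}_q^n$ to $\{1,\dots,k\}$ and maps $g_1,\dots,g_k$ from $\mathbb{Z}_q^m$ to $\{1,2\}$, the invasion $h=f\times(g_1,\dots,g_k)$ is the map on $\mathbb{Z}_q^{n+m}$ given by $h(x,y)=g_{f(x)}(y)$ for $x\in\mathbb{Z}_q^n$, $y\in\mathbb{Z}_q^m$. For $m\ge1$, $G^i_t$ is the map $\mathbb{Z}_q^m\to\{1,2\}$ taking value $1$ exactly on $\bigcup_{j=i}^{i+t-1}M^j$ (indices taken cyclically modulo $q$ in $\{1,\dots,q\}$) and $2$ elsewhere. For $m=0$ ($H(0,q)$ has a single vertex), $G^i_t$ maps that vertex to $1$ if $1\le i\le t$ and to $2$ if $t+1\le i\le q$. -}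

module Defs where

open import Data.Nat using (ℕ; zero; suc; _+_; _*_; _∸_; _^_; _≤_; _<_; _≡ᵇ_; _<ᵇ_; _≤ᵇ_)
open import Data.Fin using (Fin; toℕ; splitAt)
open import Data.Vec using (Vec; []; _∷_; take; drop)
open import Data.List using (List; []; _∷_; map; concatMap; allFin; length; filterᵇ)
open import Data.Bool using (Bool; true; false; if_then_else_; _∧_; not)
open import Data.Sum using (_⊎_; inj₁; inj₂)
open import Data.Product using (∃; _×_)
open import Relation.Binary.PropositionalEquality using (_≡_; _≢_)

Vertex : ℕ → ℕ → Set
Vertex q n = Vec (Fin q) n

_=F_ : ∀ {q} → Fin q → Fin q → Bool
a =F b = toℕ a ≡ᵇ toℕ b

ham : ∀ {q n} → Vertex q n → Vertex q n → ℕ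
ham [] [] = 0
ham (a ∷ x) (b ∷ y) = (if a =F b then 0 else 1) + ham x y

allVertices : ∀ q n → List (Vertex q n)
allVertices q zero = [] ∷ []
allVertices q (suc n) = concatMap (λ a → map (a ∷_) (allVertices q n)) (allFin q)

count : ∀ {A : Set} → (A → Bool) → List A → ℕ
count p xs = length (filterᵇ p xs)

nbrCount : ∀ {q n k} → (Vertex q n → Fin k) → Vertex q n → Fin k → ℕ
nbrCount {q} {n} f x j = count (λ y → (ham x y ≡ᵇ 1) ∧ (f y =F j)) (allVertices q n)

-- Perfect k-colouring of H(n,q) with quotient matrix S (colours 1..k are Fin k = 0..k-1).
IsPerfectColoring : ∀ {q n k} → (Vertex q n → Fin k) → (Fin k → Fin k → ℕ) → Set
IsPerfectColoring {q} {n} {k} f S =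
  ((c : Fin k) → ∃ λ x → f x ≡ c)
  × ((x : Vertex q n) (j : Fin k) → nbrCount f x j ≡ S (f x) j)

-- Quotient matrix of a (b,c)-colouring of H(N,q); colour 1 = Fin index 0, colour 2 = index 1.
bcMatrix : ℕ → ℕ → ℕ → ℕ → Fin 2 → Fin 2 → ℕ
bcMatrix N q b c Fin.zero Fin.zero = N * (q ∸ 1) ∸ b
bcMatrix N q b c Fin.zero (Fin.suc Fin.zero) = b
bcMatrix N q b c (Fin.suc Fin.zero) Fin.zero = c
bcMatrix N q b c (Fin.suc Fin.zero) (Fin.suc Fin.zero) = N * (q ∸ 1) ∸ c

IsBCColoring : ∀ {q N} → ℕ → ℕ → (Vertex q N → Fin 2) → Set
IsBCColoring {q} {N} b c h = IsPerfectColoring h (bcMatrix N q b c)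

IsDist2MDS : ∀ q m → (Vertex q m → Bool) → Set
IsDist2MDS q m C =
  (count C (allVertices q m) ≡ q ^ (m ∸ 1))
  × ((x y : Vertex q m) → C x ≡ true → C y ≡ true → x ≢ y → 2 ≤ ham x y)

-- A partition M^1,...,M^q of the vertex set of H(m,q) into q pairwise disjoint
-- distance-2 MDS codes, encoded by the map M sending each vertex to the index of
-- its part (Fin index j corresponds to M^{j+1}).
IsMDSPartition : ∀ q m → (Vertex q m → Fin q) → Set
IsMDSPartition q m M = (j : Fin q) → IsDist2MDS q m (λ y → M y =F j)

-- G^i_t (Fin index i corresponds to the paper's i+1; colour 1 = index 0, 2 = index 1).
-- m = 0: the single vertex gets colour 1 iff i+1 ≤ t.
-- m ≥ 1: y gets colour 1 iff y ∈ M^{i+1} ∪ ... ∪ M^{i+t} (cyclically), i.e. iff the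
--        cyclic offset (index(M y) - i) mod q is < t.
G : ∀ q m → (Vertex q m → Fin q) → Fin q → ℕ → Vertex q m → Fin 2
G q zero M i t y = if toℕ i <ᵇ t then Fin.zero else Fin.suc Fin.zero
G q (suc m) M i t y =
  if offset <ᵇ t then Fin.zero else Fin.suc Fin.zero
  where
  offset : ℕ
  offset = if toℕ i ≤ᵇ toℕ (M y) then toℕ (M y) ∸ toℕ i else toℕ (M y) + q ∸ toℕ i

invasion : ∀ {q n m k} → (Vertex q n → Fin k) → (Fin k → Vertex q m → Fin 2)
         → Vertex q (n + m) → Fin 2
invasion {n = n} f g z = g (f (take n z)) (drop n z)

-- Quotient matrix of part (1), colours Fin (q + 1): indices < q are colours 1..q,
-- index q is colour q+1.
S1 : ∀ q → (α' α β γ δ : ℕ) → Fin (q + 1) → Fin (q + 1) → ℕ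
S1 q α' α β γ δ i j with splitAt q i | splitAt q j
... | inj₁ i' | inj₁ j' = if i' =F j' then α' else α
... | inj₁ _  | inj₂ _  = β
... | inj₂ _  | inj₁ _  = γ
... | inj₂ _  | inj₂ _  = δ

g1 : ∀ q m → (Vertex q m → Fin q) → ℕ → Fin 2 → Fin (q + 1) → Vertex q m → Fin 2
g1 q m M t l c y with splitAt q c
... | inj₁ i = G q m M i t y
... | inj₂ _ = l

S2 : ∀ q → (α β γ δ : ℕ) → Fin (q + q) → Fin (q + q) → ℕ
S2 q α β γ δ i j with splitAt q i | splitAt q j
... | inj₁ _ | inj₁ _ = α
... | inj₁ _ | inj₂ _ = β
... | inj₂ _ | inj₁ _ = γ
... | inj₂ _ | inj₂ _ = δ

g2 : ∀ q m → (Vertex q m → Fin q) → ℕ → ℕ → Fin (q + q) → Vertex q m → Fin 2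
g2 q m M t₁ t₂ c y with splitAt q c
... | inj₁ i = G q m M i t₁ y
... | inj₂ i = G q m M i t₂ y

module Submission where

-- All counting is done with finite sums: ΣV sums over the vertices of H(n,q) and nbrs x P
-- counts the neighbours of x with property P.  The argument has three ingredients.
-- (i)  Invasions: a neighbour of (x, y) in H(n+m,q) differs from it either in y or in x, so
--      for a perfect f with quotient matrix S the number of neighbours of colour c of (x, y)
--      under h = f × (g_1,...,g_k) is  nbrCount g_{f x} y c + Σ_j S(f x, j) [g_j(y) = c]
--      (invasion-nbrCount).  Since H(N,q) is regular of degree N(q-1), a surjective 2-colouring
--      is a (b,c)-colouring once the off-diagonal counts are constant (invasion-bc).
-- (ii) A partition of H(m,q) into distance-2 MDS codes is a proper q-colouring, hence perfect
--      with quotient matrix m(J - I): every line through y meets every part exactly once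
--      (proper-nbrCount).
-- (iii) The maps G^i_t: for every y exactly t of G^1_t(y), ..., G^q_t(y) equal colour 1
--      (G-fibre), and a vertex of colour c under G^i_t has m·#(other class) neighbours of the
--      other colour (G-nbrCount); both reduce to bijectivity of cyclic offsets mod q.
-- Each part of the proposition then verifies the local condition of invasion-bc block by
-- block (modules Part1 and Part2), using γ = α + m (and β = δ + m) to merge the fibre count
-- of G with the quotient-matrix count.

open import Defs
open import Data.Nat using (ℕ; zero; suc; _+_; _*_; _∸_; _≤_; _<_; _≡ᵇ_; _<ᵇ_; _≤ᵇ_; z≤n; s≤s; _<?_; _≟_)
open import Data.Nat.Properties
open import Algebra.Properties.Semiring.Sum +-*-semiring
  using (sum; sum-syntax; sum-cong-≗; ∑-distrib-+; ∑-comm; *-distribˡ-sum; sum-replicate-zero)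
open import Data.Fin as Fin using (Fin; toℕ; splitAt; _↑ˡ_; _↑ʳ_; fromℕ<)
open import Data.Fin.Properties using (toℕ-injective; toℕ-fromℕ<; toℕ<n; splitAt-↑ˡ; splitAt-↑ʳ; splitAt⁻¹-↑ˡ; splitAt⁻¹-↑ʳ) renaming (suc-injective to fsuc-injective)
open import Data.Fin.Patterns using (0F; 1F)
open import Data.Vec using (Vec; []; _∷_; take; drop; _++_; replicate)
open import Data.Vec.Properties using (take++drop≡id)
open import Data.List as List using (List; concat; tabulate; filterᵇ; length)
open import Data.List.Properties using (filter-++; length-++)
open import Data.Bool using (Bool; true; false; if_then_else_; _∧_; not; T; T?)
open import Data.Sum using (_⊎_; inj₁; inj₂)
open import Data.Product using (∃; ∃₂; _×_; _,_; proj₁; proj₂)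
open import Data.Empty using (⊥-elim)
open import Relation.Nullary using (yes; no)
open import Data.Bool.Properties using (T-≡)
open import Function.Bundles using (Equivalence)
open import Relation.Binary.PropositionalEquality

𝟙 : Bool → ℕ
𝟙 true = 1
𝟙 false = 0

𝟙-∧ : ∀ a b → 𝟙 (a ∧ b) ≡ 𝟙 a * 𝟙 b
𝟙-∧ true b = sym (+-identityʳ (𝟙 b))
𝟙-∧ false b = refl

*-zero-weights : ∀ {a} A B → a ≡ 0 → A * a ≡ B * a
*-zero-weights A B refl = trans (*-zeroʳ A) (sym (*-zeroʳ B))

∑-ones : ∀ n → ∑[ i < n ] 1 ≡ n
∑-ones zero = refl
∑-ones (suc n) = cong suc (∑-ones n)

∑-split : ∀ a b (f : Fin (a + b) → ℕ) →
          sum f ≡ ∑[ i < a ] f (i ↑ˡ b) + ∑[ i < b ] f (a ↑ʳ i)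
∑-split zero b f = refl
∑-split (suc a) b f =
  trans (cong (f 0F +_) (∑-split a b (λ i → f (Fin.suc i)))) (sym (+-assoc (f 0F) _ _))

∑-δ : ∀ {n} (c : Fin n) (f : Fin n → ℕ) → ∑[ j < n ] (𝟙 (c =F j) * f j) ≡ f c
∑-δ {suc n} 0F f = trans (cong (λ s → f 0F + 0 + s) (sum-replicate-zero n)) (trans (+-identityʳ _) (+-identityʳ _))
∑-δ {suc n} (Fin.suc c) f = ∑-δ c (λ j → f (Fin.suc j))

ΣV : ∀ q n → (Vertex q n → ℕ) → ℕ
ΣV q zero f = f []
ΣV q (suc n) f = ∑[ a < q ] ΣV q n (λ x → f (a ∷ x))

ΣV-cong : ∀ q n {f g : Vertex q n → ℕ} → (∀ x → f x ≡ g x) → ΣV q n f ≡ ΣV q n g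
ΣV-cong q zero e = e []
ΣV-cong q (suc n) e = sum-cong-≗ (λ a → ΣV-cong q n (λ x → e (a ∷ x)))

ΣV-distrib-+ : ∀ q n (f g : Vertex q n → ℕ) → ΣV q n (λ x → f x + g x) ≡ ΣV q n f + ΣV q n g
ΣV-distrib-+ q zero f g = refl
ΣV-distrib-+ q (suc n) f g =
  trans (sum-cong-≗ (λ a → ΣV-distrib-+ q n (λ x → f (a ∷ x)) (λ x → g (a ∷ x)))) (∑-distrib-+ {q} _ _)

ΣV-distribˡ-* : ∀ q n k (f : Vertex q n → ℕ) → ΣV q n (λ x → k * f x) ≡ k * ΣV q n f
ΣV-distribˡ-* q zero k f = refl
ΣV-distribˡ-* q (suc n) k f =
  trans (sum-cong-≗ (λ a → ΣV-distribˡ-* q n k (λ x → f (a ∷ x)))) (sym (*-distribˡ-sum {q} k _))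

ΣV-zero : ∀ q n → ΣV q n (λ _ → 0) ≡ 0
ΣV-zero q n = ΣV-distribˡ-* q n 0 (λ _ → 0)

ΣV-∑-comm : ∀ q n k (F : Vertex q n → Fin k → ℕ) →
            ΣV q n (λ x → ∑[ j < k ] F x j) ≡ ∑[ j < k ] ΣV q n (λ x → F x j)
ΣV-∑-comm q zero k F = refl
ΣV-∑-comm q (suc n) k F =
  trans (sum-cong-≗ (λ a → ΣV-∑-comm q n k (λ x → F (a ∷ x)))) (∑-comm {q} {k} _)

ΣV-++ : ∀ q n m (f : Vertex q (n + m) → ℕ) → ΣV q (n + m) f ≡ ΣV q n (λ x → ΣV q m (λ y → f (x ++ y)))
ΣV-++ q zero m f = refl
ΣV-++ q (suc n) m f = sum-cong-≗ (λ a → ΣV-++ q n m (λ z → f (a ∷ z)))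

count-++ : ∀ {A : Set} (p : A → Bool) xs ys → count p (xs List.++ ys) ≡ count p xs + count p ys
count-++ p xs ys = trans (cong length (filter-++ (λ x → T? (p x)) xs ys)) (length-++ (filterᵇ p xs))

count-map : ∀ {A B : Set} (p : B → Bool) (h : A → B) xs → count p (List.map h xs) ≡ count (λ x → p (h x)) xs
count-map p h List.[] = refl
count-map p h (x List.∷ xs) with p (h x)
... | true = cong suc (count-map p h xs)
... | false = count-map p h xs

count-concat-tabulate : ∀ {A B : Set} k (p : A → Bool) (g : B → List A) (h : Fin k → B) →
                        count p (concat (List.map g (tabulate h))) ≡ ∑[ i < k ] count p (g (h i))
count-concat-tabulate zero p g h = refl
count-concat-tabulate (suc k) p g h =
  trans (count-++ p (g (h 0F)) _) (cong (count p (g (h 0F)) +_) (count-concat-tabulate k p g (λ i → h (Fin.suc i))))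

count-allVertices : ∀ q n (p : Vertex q n → Bool) → count p (allVertices q n) ≡ ΣV q n (λ x → 𝟙 (p x))
count-allVertices q zero p with p []
... | true = refl
... | false = refl
count-allVertices q (suc n) p =
  trans (count-concat-tabulate q p _ (λ a → a))
        (sum-cong-≗ (λ a → trans (count-map p (a ∷_) (allVertices q n)) (count-allVertices q n (λ x → p (a ∷ x)))))

≡ᵇ-true : ∀ {a b} → a ≡ b → (a ≡ᵇ b) ≡ true
≡ᵇ-true {a} refl = Equivalence.to T-≡ (≡⇒≡ᵇ a a refl)

≡ᵇ-sound : ∀ {a b} → (a ≡ᵇ b) ≡ true → a ≡ b
≡ᵇ-sound {a} {b} e = ≡ᵇ⇒≡ a b (Equivalence.from T-≡ e)

=F-refl : ∀ {q} (a : Fin q) → (a =F a) ≡ true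
=F-refl a = ≡ᵇ-true {toℕ a} refl

=F-true : ∀ {q} {a b : Fin q} → a ≡ b → (a =F b) ≡ true
=F-true {a = a} refl = =F-refl a

=F-sound : ∀ {q} {a b : Fin q} → (a =F b) ≡ true → a ≡ b
=F-sound e = toℕ-injective (≡ᵇ-sound e)

=F-false : ∀ {q} {a b : Fin q} → a ≢ b → (a =F b) ≡ false
=F-false {a = a} {b} a≢b with a =F b in e
... | true = ⊥-elim (a≢b (=F-sound e))
... | false = refl

ham-refl : ∀ {q n} (x : Vertex q n) → ham x x ≡ 0
ham-refl [] = refl
ham-refl (a ∷ x) rewrite =F-refl a = ham-refl x

ham-++ : ∀ {q n m} (x x' : Vertex q n) (y y' : Vertex q m) → ham (x ++ y) (x' ++ y') ≡ ham x x' + ham y y'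
ham-++ [] [] y y' = refl
ham-++ (a ∷ x) (b ∷ x') y y' =
  trans (cong ((if a =F b then 0 else 1) +_) (ham-++ x x' y y')) (sym (+-assoc (if a =F b then 0 else 1) _ _))

ΣV-point : ∀ q n (x : Vertex q n) (f : Vertex q n → ℕ) → ΣV q n (λ x' → 𝟙 (ham x x' ≡ᵇ 0) * f x') ≡ f x
ΣV-point q zero [] f = +-identityʳ (f [])
ΣV-point q (suc n) (b ∷ x) f =
  begin
    ∑[ a < q ] ΣV q n (λ x' → 𝟙 ((if b =F a then 0 else 1) + ham x x' ≡ᵇ 0) * f (a ∷ x'))
  ≡⟨ sum-cong-≗ (λ a → ΣV-cong q n (split-first a)) ⟩
    ∑[ a < q ] ΣV q n (λ x' → 𝟙 (b =F a) * (𝟙 (ham x x' ≡ᵇ 0) * f (a ∷ x')))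
  ≡⟨ sum-cong-≗ (λ a → trans (ΣV-distribˡ-* q n (𝟙 (b =F a)) _) (cong (𝟙 (b =F a) *_) (ΣV-point q n x (λ x' → f (a ∷ x'))))) ⟩
    ∑[ a < q ] (𝟙 (b =F a) * f (a ∷ x))
  ≡⟨ ∑-δ b (λ a → f (a ∷ x)) ⟩
    f (b ∷ x)
  ∎
  where
  open ≡-Reasoning
  split-first : ∀ a x' → 𝟙 ((if b =F a then 0 else 1) + ham x x' ≡ᵇ 0) * f (a ∷ x')
                       ≡ 𝟙 (b =F a) * (𝟙 (ham x x' ≡ᵇ 0) * f (a ∷ x'))
  split-first a x' with b =F a
  ... | true = sym (+-identityʳ _)
  ... | false = refl

nbrs : ∀ {q n} → Vertex q n → (Vertex q n → Bool) → ℕ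
nbrs {q} {n} x P = ΣV q n (λ x' → 𝟙 ((ham x x' ≡ᵇ 1) ∧ P x'))

nbrCount≡nbrs : ∀ {q n k} (f : Vertex q n → Fin k) x j → nbrCount f x j ≡ nbrs x (λ x' → f x' =F j)
nbrCount≡nbrs {q} {n} f x j = count-allVertices q n _

nbrCount-cong : ∀ {q n k} {f g : Vertex q n → Fin k} → (∀ y → f y ≡ g y) → ∀ x j → nbrCount f x j ≡ nbrCount g x j
nbrCount-cong {q} {n} {f = f} {g} f≗g x j =
  trans (nbrCount≡nbrs f x j)
        (trans (ΣV-cong q n (λ y → cong (λ c → 𝟙 ((ham x y ≡ᵇ 1) ∧ (c =F j))) (f≗g y)))
               (sym (nbrCount≡nbrs g x j)))

-- Hamming distances add over concatenation, and a + b = 1 exactly when (a, b) is (0, 1) or (1, 0).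
distance-one-split : ∀ a b Q → 𝟙 ((a + b ≡ᵇ 1) ∧ Q) ≡ 𝟙 (a ≡ᵇ 0) * 𝟙 ((b ≡ᵇ 1) ∧ Q) + 𝟙 (a ≡ᵇ 1) * (𝟙 (b ≡ᵇ 0) * 𝟙 Q)
distance-one-split zero b Q = sym (trans (+-identityʳ _) (+-identityʳ _))
distance-one-split (suc zero) b Q = trans (𝟙-∧ (b ≡ᵇ 0) Q) (sym (+-identityʳ _))
distance-one-split (suc (suc a)) b Q = refl

nbrs-++ : ∀ {q n m} (P : Vertex q (n + m) → Bool) (x : Vertex q n) (y : Vertex q m) →
          nbrs (x ++ y) P ≡ nbrs y (λ y' → P (x ++ y')) + nbrs x (λ x' → P (x' ++ y))
nbrs-++ {q} {n} {m} P x y =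
  begin
    nbrs (x ++ y) P
  ≡⟨ ΣV-++ q n m _ ⟩
    ΣV q n (λ x' → ΣV q m (λ y' → 𝟙 ((ham (x ++ y) (x' ++ y') ≡ᵇ 1) ∧ P (x' ++ y'))))
  ≡⟨ ΣV-cong q n (λ x' → ΣV-cong q m (λ y' → split x' y')) ⟩
    ΣV q n (λ x' → ΣV q m (λ y' → 𝟙 (ham x x' ≡ᵇ 0) * nearY x' y' + 𝟙 (ham x x' ≡ᵇ 1) * (𝟙 (ham y y' ≡ᵇ 0) * 𝟙 (P (x' ++ y')))))
  ≡⟨ ΣV-cong q n (λ x' → trans (ΣV-distrib-+ q m _ _) (cong₂ _+_ (ΣV-distribˡ-* q m (𝟙 (ham x x' ≡ᵇ 0)) (nearY x')) (inner x'))) ⟩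
    ΣV q n (λ x' → 𝟙 (ham x x' ≡ᵇ 0) * ΣV q m (nearY x') + 𝟙 (ham x x' ≡ᵇ 1) * 𝟙 (P (x' ++ y)))
  ≡⟨ ΣV-distrib-+ q n _ _ ⟩
    ΣV q n (λ x' → 𝟙 (ham x x' ≡ᵇ 0) * ΣV q m (nearY x')) + ΣV q n (λ x' → 𝟙 (ham x x' ≡ᵇ 1) * 𝟙 (P (x' ++ y)))
  ≡⟨ cong₂ _+_ (ΣV-point q n x (λ x' → ΣV q m (nearY x'))) (ΣV-cong q n (λ x' → sym (𝟙-∧ (ham x x' ≡ᵇ 1) _))) ⟩
    nbrs y (λ y' → P (x ++ y')) + nbrs x (λ x' → P (x' ++ y))
  ∎
  where
  open ≡-Reasoning
  nearY : Vertex q n → Vertex q m → ℕ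
  nearY x' y' = 𝟙 ((ham y y' ≡ᵇ 1) ∧ P (x' ++ y'))
  split : ∀ x' y' → 𝟙 ((ham (x ++ y) (x' ++ y') ≡ᵇ 1) ∧ P (x' ++ y'))
                  ≡ 𝟙 (ham x x' ≡ᵇ 0) * nearY x' y' + 𝟙 (ham x x' ≡ᵇ 1) * (𝟙 (ham y y' ≡ᵇ 0) * 𝟙 (P (x' ++ y')))
  split x' y' = trans (cong (λ d → 𝟙 ((d ≡ᵇ 1) ∧ P (x' ++ y'))) (ham-++ x x' y y')) (distance-one-split (ham x x') (ham y y') _)
  inner : ∀ x' → ΣV q m (λ y' → 𝟙 (ham x x' ≡ᵇ 1) * (𝟙 (ham y y' ≡ᵇ 0) * 𝟙 (P (x' ++ y')))) ≡ 𝟙 (ham x x' ≡ᵇ 1) * 𝟙 (P (x' ++ y))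
  inner x' = trans (ΣV-distribˡ-* q m (𝟙 (ham x x' ≡ᵇ 1)) _) (cong (𝟙 (ham x x' ≡ᵇ 1) *_) (ΣV-point q m y (λ y' → 𝟙 (P (x' ++ y')))))

nbrs-line : ∀ {q} (b : Fin q) (P : Vertex q 1 → Bool) → nbrs (b ∷ []) P ≡ ∑[ a < q ] 𝟙 (not (b =F a) ∧ P (a ∷ []))
nbrs-line b P = sum-cong-≗ on-line
  where
  on-line : ∀ a → 𝟙 ((ham (b ∷ []) (a ∷ []) ≡ᵇ 1) ∧ P (a ∷ [])) ≡ 𝟙 (not (b =F a) ∧ P (a ∷ []))
  on-line a with b =F a
  ... | true = refl
  ... | false = refl

∑-off-point : ∀ {q} (b : Fin q) (Q : Fin q → Bool) →
              ∑[ a < q ] 𝟙 (not (b =F a) ∧ Q a) + 𝟙 (Q b) ≡ ∑[ a < q ] 𝟙 (Q a)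
∑-off-point {q} b Q =
  trans (cong (∑[ a < q ] 𝟙 (not (b =F a) ∧ Q a) +_) (sym (∑-δ b (λ a → 𝟙 (Q a)))))
        (trans (sym (∑-distrib-+ {q} _ _)) (sum-cong-≗ split))
  where
  split : ∀ a → 𝟙 (not (b =F a) ∧ Q a) + 𝟙 (b =F a) * 𝟙 (Q a) ≡ 𝟙 (Q a)
  split a with b =F a | Q a
  ... | true | true = refl
  ... | true | false = refl
  ... | false | true = refl
  ... | false | false = refl

degree : ∀ q N (z : Vertex q N) → nbrs z (λ _ → true) ≡ N * (q ∸ 1)
degree q zero [] = refl
degree q (suc N) (b ∷ z) =
  trans (nbrs-++ (λ _ → true) (b ∷ []) z)
        (trans (cong₂ _+_ (degree q N z) others) (+-comm (N * (q ∸ 1)) (q ∸ 1)))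
  where
  others : nbrs (b ∷ []) (λ _ → true) ≡ q ∸ 1
  others = trans (nbrs-line b (λ _ → true))
                 (trans (sym (m+n∸n≡m _ 1)) (cong (_∸ 1) (trans (∑-off-point b (λ _ → true)) (∑-ones q))))

nbrs-by-colour : ∀ {q n k} (f : Vertex q n → Fin k) (φ : Fin k → Bool) x →
                 nbrs x (λ x' → φ (f x')) ≡ ∑[ j < k ] (nbrCount f x j * 𝟙 (φ j))
nbrs-by-colour {q} {n} {k} f φ x =
  begin
    nbrs x (λ x' → φ (f x'))
  ≡⟨ ΣV-cong q n by-colour ⟩
    ΣV q n (λ x' → ∑[ j < k ] (𝟙 (φ j) * adjOf x' j))
  ≡⟨ ΣV-∑-comm q n k _ ⟩
    ∑[ j < k ] ΣV q n (λ x' → 𝟙 (φ j) * adjOf x' j)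
  ≡⟨ sum-cong-≗ (λ j → trans (ΣV-distribˡ-* q n (𝟙 (φ j)) _) (trans (cong (𝟙 (φ j) *_) (sym (nbrCount≡nbrs f x j))) (*-comm (𝟙 (φ j)) _))) ⟩
    ∑[ j < k ] (nbrCount f x j * 𝟙 (φ j))
  ∎
  where
  open ≡-Reasoning
  adjOf : Vertex q n → Fin k → ℕ
  adjOf x' j = 𝟙 ((ham x x' ≡ᵇ 1) ∧ (f x' =F j))
  by-colour : ∀ x' → 𝟙 ((ham x x' ≡ᵇ 1) ∧ φ (f x')) ≡ ∑[ j < k ] (𝟙 (φ j) * adjOf x' j)
  by-colour x' = begin
      𝟙 ((ham x x' ≡ᵇ 1) ∧ φ (f x'))
    ≡⟨ 𝟙-∧ (ham x x' ≡ᵇ 1) (φ (f x')) ⟩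
      𝟙 (ham x x' ≡ᵇ 1) * 𝟙 (φ (f x'))
    ≡⟨ cong (𝟙 (ham x x' ≡ᵇ 1) *_) (sym (∑-δ (f x') (λ j → 𝟙 (φ j)))) ⟩
      𝟙 (ham x x' ≡ᵇ 1) * ∑[ j < k ] (𝟙 (f x' =F j) * 𝟙 (φ j))
    ≡⟨ *-distribˡ-sum {k} (𝟙 (ham x x' ≡ᵇ 1)) _ ⟩
      ∑[ j < k ] (𝟙 (ham x x' ≡ᵇ 1) * (𝟙 (f x' =F j) * 𝟙 (φ j)))
    ≡⟨ sum-cong-≗ (λ j → reorder (𝟙 (ham x x' ≡ᵇ 1)) (𝟙 (f x' =F j)) (𝟙 (φ j))) ⟩
      ∑[ j < k ] (𝟙 (φ j) * (𝟙 (ham x x' ≡ᵇ 1) * 𝟙 (f x' =F j)))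
    ≡⟨ sum-cong-≗ (λ j → cong (𝟙 (φ j) *_) (sym (𝟙-∧ (ham x x' ≡ᵇ 1) (f x' =F j)))) ⟩
      ∑[ j < k ] (𝟙 (φ j) * adjOf x' j)
    ∎
    where
    reorder : ∀ a b c → a * (b * c) ≡ c * (a * b)
    reorder a b c = trans (sym (*-assoc a b c)) (*-comm (a * b) c)

opp : Fin 2 → Fin 2
opp 0F = 1F
opp 1F = 0F

opp-differs : ∀ c → (c =F opp c) ≡ false
opp-differs 0F = refl
opp-differs 1F = refl

two-colour-degree : ∀ {q N} (h : Vertex q N → Fin 2) z → nbrCount h z 0F + nbrCount h z 1F ≡ N * (q ∸ 1)
two-colour-degree {q} {N} h z =
  trans (cong₂ _+_ (nbrCount≡nbrs h z 0F) (nbrCount≡nbrs h z 1F))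
        (trans (sym (ΣV-distrib-+ q N _ _)) (trans (ΣV-cong q N either-colour) (degree q N z)))
  where
  either-colour : ∀ z' → 𝟙 ((ham z z' ≡ᵇ 1) ∧ (h z' =F 0F)) + 𝟙 ((ham z z' ≡ᵇ 1) ∧ (h z' =F 1F))
                       ≡ 𝟙 ((ham z z' ≡ᵇ 1) ∧ true)
  either-colour z' with ham z z' ≡ᵇ 1 | h z'
  ... | true | 0F = refl
  ... | true | 1F = refl
  ... | false | 0F = refl
  ... | false | 1F = refl

-- By regularity, a surjective 2-colouring is a (D 0, D 1)-colouring as soon as every
-- vertex of colour c has exactly D c neighbours of the other colour.
bc-coloring-criterion : ∀ {q N} (h : Vertex q N → Fin 2) (D : Fin 2 → ℕ) →
  (∀ c → ∃ λ z → h z ≡ c) → (∀ z → nbrCount h z (opp (h z)) ≡ D (h z)) → IsBCColoring (D 0F) (D 1F) h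
bc-coloring-criterion {q} {N} h D surj other = surj , perfect
  where
  perfect : ∀ z j → nbrCount h z j ≡ bcMatrix N q (D 0F) (D 1F) (h z) j
  perfect z j with h z | other z
  ... | 0F | o with j
  ...   | 0F = trans (sym (m+n∸n≡m _ (nbrCount h z 1F))) (cong₂ _∸_ (two-colour-degree h z) o)
  ...   | 1F = o
  perfect z j | 1F | o with j
  ...   | 0F = o
  ...   | 1F = trans (sym (m+n∸m≡n (nbrCount h z 0F) _)) (cong₂ _∸_ (two-colour-degree h z) o)

take-++ : ∀ {A : Set} {n m} (x : Vec A n) (y : Vec A m) → take n (x ++ y) ≡ x
take-++ [] y = refl
take-++ (a ∷ x) y = cong (a ∷_) (take-++ x y)

drop-++ : ∀ {A : Set} {n m} (x : Vec A n) (y : Vec A m) → drop n (x ++ y) ≡ y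
drop-++ [] y = refl
drop-++ (a ∷ x) y = drop-++ x y

invasion-++ : ∀ {q n m k} (f : Vertex q n → Fin k) (g : Fin k → Vertex q m → Fin 2) x y →
              invasion f g (x ++ y) ≡ g (f x) y
invasion-++ f g x y = cong₂ (λ x' y' → g (f x') y') (take-++ x y) (drop-++ x y)

invasion-nbrCount : ∀ {q n m k} (f : Vertex q n → Fin k) (S : Fin k → Fin k → ℕ) (g : Fin k → Vertex q m → Fin 2) →
  IsPerfectColoring f S → ∀ x y c →
  nbrCount (invasion f g) (x ++ y) c ≡ nbrCount (g (f x)) y c + ∑[ j < k ] (S (f x) j * 𝟙 (g j y =F c))
invasion-nbrCount {q} {n} {m} {k} f S g (_ , quotient) x y c =
  begin
    nbrCount (invasion f g) (x ++ y) c
  ≡⟨ nbrCount≡nbrs (invasion f g) (x ++ y) c ⟩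
    nbrs (x ++ y) (λ z → invasion f g z =F c)
  ≡⟨ nbrs-++ (λ z → invasion f g z =F c) x y ⟩
    nbrs y (λ y' → invasion f g (x ++ y') =F c) + nbrs x (λ x' → invasion f g (x' ++ y) =F c)
  ≡⟨ cong₂ _+_ (ΣV-cong q m (λ y' → cong (λ b → 𝟙 ((ham y y' ≡ᵇ 1) ∧ (b =F c))) (invasion-++ f g x y')))
               (ΣV-cong q n (λ x' → cong (λ b → 𝟙 ((ham x x' ≡ᵇ 1) ∧ (b =F c))) (invasion-++ f g x' y))) ⟩
    nbrs y (λ y' → g (f x) y' =F c) + nbrs x (λ x' → g (f x') y =F c)
  ≡⟨ cong₂ _+_ (sym (nbrCount≡nbrs (g (f x)) y c)) (nbrs-by-colour f (λ j → g j y =F c) x) ⟩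
    nbrCount (g (f x)) y c + ∑[ j < k ] (nbrCount f x j * 𝟙 (g j y =F c))
  ≡⟨ cong (nbrCount (g (f x)) y c +_) (sum-cong-≗ (λ j → cong (_* 𝟙 (g j y =F c)) (quotient x j))) ⟩
    nbrCount (g (f x)) y c + ∑[ j < k ] (S (f x) j * 𝟙 (g j y =F c))
  ∎
  where open ≡-Reasoning

invasion-bc : ∀ {q n m k} (f : Vertex q n → Fin k) (S : Fin k → Fin k → ℕ)
  (g : Fin k → Vertex q m → Fin 2) (D : Fin 2 → ℕ) → IsPerfectColoring f S →
  (∀ c → ∃₂ λ j y → g j y ≡ c) →
  (∀ j y c → g j y ≡ c → nbrCount (g j) y (opp c) + ∑[ j' < k ] (S j j' * 𝟙 (g j' y =F opp c)) ≡ D c) →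
  IsBCColoring {q} {n + m} (D 0F) (D 1F) (invasion f g)
invasion-bc {q} {n} {m} f S g D perfect occurs local = bc-coloring-criterion h D surjective other
  where
  h : Vertex q (n + m) → Fin 2
  h = invasion f g
  surjective : ∀ c → ∃ λ z → h z ≡ c
  surjective c with occurs c
  ... | j , y , gjy≡c with proj₁ perfect j
  ...   | x , fx≡j = x ++ y , trans (invasion-++ f g x y) (trans (cong (λ i → g i y) fx≡j) gjy≡c)
  at-split : ∀ x y → nbrCount h (x ++ y) (opp (h (x ++ y))) ≡ D (h (x ++ y))
  at-split x y = trans (invasion-nbrCount f S g perfect x y _) (local (f x) y _ (sym (invasion-++ f g x y)))
  other : ∀ z → nbrCount h z (opp (h z)) ≡ D (h z)
  other z = subst (λ w → nbrCount h w (opp (h w)) ≡ D (h w)) (take++drop≡id n z) (at-split (take n z) (drop n z))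

∑-bounded : ∀ n (f : Fin n → ℕ) → (∀ j → f j ≤ 1) → sum f ≤ n
∑-bounded zero f f≤1 = z≤n
∑-bounded (suc n) f f≤1 = +-mono-≤ (f≤1 0F) (∑-bounded n (λ i → f (Fin.suc i)) (λ i → f≤1 (Fin.suc i)))

unit-split : ∀ a r n → a ≤ 1 → r ≤ n → a + r ≡ suc n → a ≡ 1 × r ≡ n
unit-split zero r n _ r≤n a+r≡1+n = ⊥-elim (<-irrefl refl (subst (_≤ n) a+r≡1+n r≤n))
unit-split (suc zero) r n _ _ a+r≡1+n = refl , suc-injective a+r≡1+n
unit-split (suc (suc a)) r n (s≤s ()) _ _

∑-saturated : ∀ n (f : Fin n → ℕ) → (∀ j → f j ≤ 1) → sum f ≡ n → ∀ j → f j ≡ 1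
∑-saturated (suc n) f f≤1 total j = at j
  where
  tail≤1 : ∀ i → f (Fin.suc i) ≤ 1
  tail≤1 i = f≤1 (Fin.suc i)
  split : f 0F ≡ 1 × ∑[ i < n ] f (Fin.suc i) ≡ n
  split = unit-split _ _ n (f≤1 0F) (∑-bounded n (λ i → f (Fin.suc i)) tail≤1) total
  at : ∀ j → f j ≡ 1
  at 0F = proj₁ split
  at (Fin.suc j) = ∑-saturated n (λ i → f (Fin.suc i)) tail≤1 (proj₂ split) j

∑-at-most-one : ∀ n (P : Fin n → Bool) → (∀ a b → P a ≡ true → P b ≡ true → a ≡ b) → ∑[ a < n ] 𝟙 (P a) ≤ 1
∑-at-most-one zero P unique = z≤n
∑-at-most-one (suc n) P unique with P 0F in P0
... | true = subst (_≤ 1) (sym (cong suc (trans (sum-cong-≗ none-after) (sum-replicate-zero n)))) ≤-refl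
  where
  none-after : ∀ i → 𝟙 (P (Fin.suc i)) ≡ 0
  none-after i with P (Fin.suc i) in Pi
  ... | true with unique 0F (Fin.suc i) P0 Pi
  ...   | ()
  none-after i | false = refl
... | false = ∑-at-most-one n (λ i → P (Fin.suc i)) (λ a b pa pb → fsuc-injective (unique (Fin.suc a) (Fin.suc b) pa pb))

-- An injective self-map of Fin q takes every value exactly once (double counting).
injective-fibre : ∀ q (φ : Fin q → Fin q) → (∀ a b → φ a ≡ φ b → a ≡ b) → ∀ j → ∑[ a < q ] 𝟙 (φ a =F j) ≡ 1
injective-fibre q φ inj = ∑-saturated q (λ j → ∑[ a < q ] 𝟙 (φ a =F j)) at-most-one total
  where
  at-most-one : ∀ j → ∑[ a < q ] 𝟙 (φ a =F j) ≤ 1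
  at-most-one j = ∑-at-most-one q (λ a → φ a =F j) (λ a b pa pb → inj a b (trans (=F-sound pa) (sym (=F-sound pb))))
  total : ∑[ j < q ] ∑[ a < q ] 𝟙 (φ a =F j) ≡ q
  total = trans (sym (∑-comm {q} {q} (λ a j → 𝟙 (φ a =F j))))
                (trans (sum-cong-≗ (λ a → trans (sum-cong-≗ {q} (λ j → sym (*-identityʳ (𝟙 (φ a =F j))))) (∑-δ (φ a) (λ _ → 1)))) (∑-ones q))

Proper : ∀ {q m k} → (Vertex q m → Fin k) → Set
Proper {q} {m} M = ∀ y y' → ham y y' ≡ 1 → M y ≢ M y'

mds-partition-proper : ∀ q m (M : Vertex q m → Fin q) → IsMDSPartition q m M → Proper M
mds-partition-proper q m M mds y y' d≡1 My≡My' = <-irrefl refl (subst (2 ≤_) d≡1 far)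
  where
  distinct : y ≢ y'
  distinct refl with trans (sym d≡1) (ham-refl y)
  ... | ()
  far : 2 ≤ ham y y'
  far = proj₂ (mds (M y)) y y' (=F-refl (M y)) (trans (cong (_=F M y) (sym My≡My')) (=F-refl (M y))) distinct

line-step : ∀ m X e → X + 𝟙 e ≡ 1 → m * 𝟙 (not e) + X ≡ suc m * 𝟙 (not e)
line-step m X true X+1≡1 = trans (cong (m * 0 +_) (suc-injective (trans (+-comm 1 X) X+1≡1))) (+-identityʳ _)
line-step m X false X≡1 = trans (cong (m * 1 +_) (trans (sym (+-identityʳ X)) X≡1)) (+-comm (m * 1) 1)

-- A proper q-colouring of H(m,q) is perfect with quotient matrix m(J - I): each line through y
-- is a q-clique, so it meets every colour class exactly once.
proper-nbrCount : ∀ q m (M : Vertex q m → Fin q) → Proper M → ∀ y j → nbrCount M y j ≡ m * 𝟙 (not (M y =F j))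
proper-nbrCount q zero M proper [] j = refl
proper-nbrCount q (suc m) M proper (a ∷ y) j =
  begin
    nbrCount M (a ∷ y) j
  ≡⟨ nbrCount≡nbrs M (a ∷ y) j ⟩
    nbrs ((a ∷ []) ++ y) (λ z → M z =F j)
  ≡⟨ nbrs-++ (λ z → M z =F j) (a ∷ []) y ⟩
    nbrs y (λ y' → M (a ∷ y') =F j) + nbrs (a ∷ []) (λ x' → M (x' ++ y) =F j)
  ≡⟨ cong₂ _+_ (trans (sym (nbrCount≡nbrs (λ y' → M (a ∷ y')) y j)) (proper-nbrCount q m (λ y' → M (a ∷ y')) proper-slice y j))
               (nbrs-line a (λ x' → M (x' ++ y) =F j)) ⟩
    m * 𝟙 (not (M (a ∷ y) =F j)) + ∑[ b < q ] 𝟙 (not (a =F b) ∧ (M (b ∷ y) =F j))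
  ≡⟨ line-step m _ (M (a ∷ y) =F j) (trans (∑-off-point a (λ b → M (b ∷ y) =F j)) (injective-fibre q (λ b → M (b ∷ y)) line-injective j)) ⟩
    suc m * 𝟙 (not (M (a ∷ y) =F j))
  ∎
  where
  open ≡-Reasoning
  proper-slice : Proper (λ y' → M (a ∷ y'))
  proper-slice y₁ y₂ d≡1 = proper (a ∷ y₁) (a ∷ y₂) (trans (cong (λ e → (if e then 0 else 1) + ham y₁ y₂) (=F-refl a)) d≡1)
  line-injective : ∀ b₁ b₂ → M (b₁ ∷ y) ≡ M (b₂ ∷ y) → b₁ ≡ b₂
  line-injective b₁ b₂ same with b₁ Fin.≟ b₂
  ... | yes b₁≡b₂ = b₁≡b₂
  ... | no b₁≢b₂ = ⊥-elim (proper (b₁ ∷ y) (b₂ ∷ y) adjacent same)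
    where
    adjacent : ham (b₁ ∷ y) (b₂ ∷ y) ≡ 1
    adjacent = cong₂ (λ e d → (if e then 0 else 1) + d) (=F-false b₁≢b₂) (ham-refl y)

proper-nbrs : ∀ q m (M : Vertex q m → Fin q) → Proper M → ∀ y (ψ : Fin q → Bool) → ψ (M y) ≡ false →
              nbrs y (λ y' → ψ (M y')) ≡ m * ∑[ j < q ] 𝟙 (ψ j)
proper-nbrs q m M proper y ψ ψMy≡false =
  trans (nbrs-by-colour M ψ y)
        (trans (sum-cong-≗ weight) (sym (*-distribˡ-sum {q} m (λ j → 𝟙 (ψ j)))))
  where
  weight : ∀ j → nbrCount M y j * 𝟙 (ψ j) ≡ m * 𝟙 (ψ j)
  weight j rewrite proper-nbrCount q m M proper y j with M y =F j in My≡j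
  ... | false = cong (_* 𝟙 (ψ j)) (*-identityʳ m)
  ... | true = *-zero-weights (m * 0) m (cong 𝟙 (trans (cong ψ (sym (=F-sound My≡j))) ψMy≡false))

offset : ℕ → ℕ → ℕ → ℕ
offset q j i = if i ≤ᵇ j then j ∸ i else j + q ∸ i

≤ᵇ-true : ∀ i j → (i ≤ᵇ j) ≡ true → i ≤ j
≤ᵇ-true i j e = ≤ᵇ⇒≤ i j (subst T (sym e) _)

≤ᵇ-false : ∀ i j → (i ≤ᵇ j) ≡ false → j < i
≤ᵇ-false i j e = ≰⇒> (λ i≤j → subst T e (≤⇒≤ᵇ i≤j))

offset-sound : ∀ q j i u → i < q → offset q j i ≡ u → (i + u ≡ j) ⊎ (i + u ≡ j + q)
offset-sound q j i u i<q refl with i ≤ᵇ j in e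
... | true = inj₁ (m+[n∸m]≡n (≤ᵇ-true i j e))
... | false = inj₂ (m+[n∸m]≡n (≤-trans (<⇒≤ i<q) (m≤n+m q j)))

offset-complete : ∀ q j i u → u < q → (i + u ≡ j) ⊎ (i + u ≡ j + q) → offset q j i ≡ u
offset-complete q j i u u<q congruent with i ≤ᵇ j in e | congruent
... | true | inj₁ refl = m+n∸m≡n i u
... | true | inj₂ i+u≡j+q = ⊥-elim (<-irrefl i+u≡j+q (+-mono-≤-< (≤ᵇ-true i j e) u<q))
... | false | inj₁ refl = ⊥-elim (<-irrefl refl (<-≤-trans (≤ᵇ-false i (i + u) e) (m≤m+n i u)))
... | false | inj₂ i+u≡j+q = trans (cong (_∸ i) (sym i+u≡j+q)) (m+n∸m≡n i u)

offset<q : ∀ q j i → i < q → j < q → offset q j i < q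
offset<q q j i i<q j<q with i ≤ᵇ j in e
... | true = ≤-<-trans (m∸n≤m j i) j<q
... | false = +-cancelˡ-< i _ _ (subst (_< i + q) (sym (m+[n∸m]≡n (≤-trans (<⇒≤ i<q) (m≤n+m q j))))
                                        (+-monoˡ-< q (≤ᵇ-false i j e)))

congruent-sym : ∀ {i u j q : ℕ} → (i + u ≡ j) ⊎ (i + u ≡ j + q) → (u + i ≡ j) ⊎ (u + i ≡ j + q)
congruent-sym {i} {u} (inj₁ e) = inj₁ (trans (+-comm u i) e)
congruent-sym {i} {u} (inj₂ e) = inj₂ (trans (+-comm u i) e)

∑-exactly-one : ∀ {q} (P : Fin q → Bool) k₀ → k₀ < q →
                (∀ i → P i ≡ true → toℕ i ≡ k₀) → (∀ i → toℕ i ≡ k₀ → P i ≡ true) → ∑[ i < q ] 𝟙 (P i) ≡ 1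
∑-exactly-one {q} P k₀ k₀<q sound complete = trans (sum-cong-≗ at-k) (∑-δ k (λ _ → 1))
  where
  k : Fin q
  k = fromℕ< k₀<q
  true≢false : true ≢ false
  true≢false ()
  at-k : ∀ i → 𝟙 (P i) ≡ 𝟙 (k =F i) * 1
  at-k i with P i in Pi | k =F i in ki
  ... | true | true = refl
  ... | false | false = refl
  ... | true | false = ⊥-elim (true≢false (trans (sym (=F-true (toℕ-injective (trans (toℕ-fromℕ< k₀<q) (sym (sound i Pi)))))) ki))
  ... | false | true = ⊥-elim (true≢false (trans (sym (complete i (trans (cong toℕ (sym (=F-sound ki))) (toℕ-fromℕ< k₀<q)))) Pi))

offsets-from : ∀ q j u → j < q → u < q → ∑[ i < q ] 𝟙 (offset q j (toℕ i) ≡ᵇ u) ≡ 1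
offsets-from q j u j<q u<q = ∑-exactly-one _ (offset q j u) (offset<q q j u u<q j<q)
  (λ i e → sym (offset-complete q j u (toℕ i) (toℕ<n i) (congruent-sym {toℕ i} {u} (offset-sound q j (toℕ i) u (toℕ<n i) (≡ᵇ-sound e)))))
  (λ i e → ≡ᵇ-true (offset-complete q j (toℕ i) u u<q (congruent-sym {u} {toℕ i} (offset-sound q j u (toℕ i) u<q (sym e)))))

-- For fixed i, every offset u < q is the offset relative to i of exactly one j, namely i + u mod q.
offsets-to : ∀ q i u → i < q → u < q → ∑[ j < q ] 𝟙 (offset q (toℕ j) i ≡ᵇ u) ≡ 1
offsets-to q i u i<q u<q with i + u <? q
... | yes i+u<q = ∑-exactly-one _ (i + u) i+u<q
  (λ j e → no-wrap j (offset-sound q (toℕ j) i u i<q (≡ᵇ-sound e)))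
  (λ j e → ≡ᵇ-true (offset-complete q (toℕ j) i u u<q (inj₁ (sym e))))
  where
  no-wrap : ∀ j → (i + u ≡ toℕ j) ⊎ (i + u ≡ toℕ j + q) → toℕ j ≡ i + u
  no-wrap j (inj₁ e) = sym e
  no-wrap j (inj₂ e) = ⊥-elim (<-irrefl refl (<-≤-trans i+u<q (subst (q ≤_) (sym e) (m≤n+m q (toℕ j)))))
... | no i+u≮q = ∑-exactly-one _ (i + u ∸ q) wrapped<q
  (λ j e → wrap j (offset-sound q (toℕ j) i u i<q (≡ᵇ-sound e)))
  (λ j e → ≡ᵇ-true (offset-complete q (toℕ j) i u u<q (inj₂ (trans (sym (m∸n+n≡m q≤i+u)) (cong (_+ q) (sym e))))))
  where
  q≤i+u : q ≤ i + u
  q≤i+u = ≮⇒≥ i+u≮q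
  wrapped<q : i + u ∸ q < q
  wrapped<q = +-cancelˡ-< q _ _ (subst (_< q + q) (sym (m+[n∸m]≡n q≤i+u)) (+-mono-< i<q u<q))
  wrap : ∀ j → (i + u ≡ toℕ j) ⊎ (i + u ≡ toℕ j + q) → toℕ j ≡ i + u ∸ q
  wrap j (inj₁ e) = ⊥-elim (<-irrefl refl (<-≤-trans (toℕ<n j) (subst (q ≤_) e q≤i+u)))
  wrap j (inj₂ e) = sym (trans (cong (_∸ q) e) (m+n∸n≡m (toℕ j) q))

<ᵇ-suc : ∀ a t → 𝟙 (a <ᵇ suc t) ≡ 𝟙 (a <ᵇ t) + 𝟙 (a ≡ᵇ t)
<ᵇ-suc zero zero = refl
<ᵇ-suc zero (suc t) = refl
<ᵇ-suc (suc a) zero = refl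
<ᵇ-suc (suc a) (suc t) = <ᵇ-suc a t

∑-below : ∀ q (o : Fin q → ℕ) → (∀ u → u < q → ∑[ i < q ] 𝟙 (o i ≡ᵇ u) ≡ 1) →
          ∀ t → t ≤ q → ∑[ i < q ] 𝟙 (o i <ᵇ t) ≡ t
∑-below q o once zero t≤q = sum-replicate-zero q
∑-below q o once (suc t) t<q =
  trans (sum-cong-≗ (λ i → <ᵇ-suc (o i) t))
        (trans (∑-distrib-+ {q} _ _) (trans (cong₂ _+_ (∑-below q o once t (<⇒≤ t<q)) (once t t<q)) (+-comm t 1)))

-- Colour 1 (index 0) for true, colour 2 (index 1) for false, as in the definition of G.
colour : Bool → Fin 2
colour b = if b then 0F else 1F

-- The number of indices i with G^i_t(y) = c: t for colour 1 and q - t for colour 2.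
classSize : ℕ → ℕ → Fin 2 → ℕ
classSize q t 0F = t
classSize q t 1F = q ∸ t

∑-colour : ∀ q (B : Fin q → Bool) t → ∑[ i < q ] 𝟙 (B i) ≡ t → ∀ c → ∑[ i < q ] 𝟙 (colour (B i) =F c) ≡ classSize q t c
∑-colour q B t ∑B≡t 0F = trans (sum-cong-≗ first) ∑B≡t
  where
  first : ∀ i → 𝟙 (colour (B i) =F 0F) ≡ 𝟙 (B i)
  first i with B i
  ... | true = refl
  ... | false = refl
∑-colour q B t ∑B≡t 1F =
  trans (sym (m+n∸n≡m _ t))
        (cong (_∸ t) (trans (cong (_ +_) (sym ∑B≡t)) (trans (sym (∑-distrib-+ {q} _ _)) (trans (sum-cong-≗ one-of) (∑-ones q)))))
  where
  one-of : ∀ i → 𝟙 (colour (B i) =F 1F) + 𝟙 (B i) ≡ 1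
  one-of i with B i
  ... | true = refl
  ... | false = refl

G-fibre : ∀ q m (M : Vertex q m → Fin q) t → t ≤ q → ∀ y c → ∑[ i < q ] 𝟙 (G q m M i t y =F c) ≡ classSize q t c
G-fibre q zero M t t≤q y =
  ∑-colour q (λ i → toℕ i <ᵇ t) t
    (∑-below q toℕ (λ u u<q → ∑-exactly-one _ u u<q (λ i → ≡ᵇ-sound) (λ i → ≡ᵇ-true)) t t≤q)
G-fibre q (suc m) M t t≤q y =
  ∑-colour q (λ i → offset q (toℕ (M y)) (toℕ i) <ᵇ t) t
    (∑-below q (λ i → offset q (toℕ (M y)) (toℕ i)) (λ u u<q → offsets-from q (toℕ (M y)) u (toℕ<n (M y)) u<q) t t≤q)

-- A vertex of colour c under G^i_t has m classSize q t c' neighbours of the other colour c':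
-- M is perfect with matrix m(J - I), and the colour classes of G^i_t are unions of parts of M.
G-nbrCount : ∀ q m (M : Vertex q m → Fin q) → (1 ≤ m → Proper M) → ∀ i t → t ≤ q → ∀ y c →
             G q m M i t y ≡ c → nbrCount (G q m M i t) y (opp c) ≡ m * classSize q t (opp c)
G-nbrCount q zero M proper i t t≤q [] c _ = refl
G-nbrCount q (suc m) M proper i t t≤q y c Gy≡c =
  trans (nbrCount≡nbrs (G q (suc m) M i t) y (opp c))
        (trans (proper-nbrs q (suc m) M (proper (s≤s z≤n)) y ψ ψMy≡false)
               (cong (suc m *_) (∑-colour q (λ j → offset q (toℕ j) (toℕ i) <ᵇ t) t ∑below (opp c))))
  where
  ψ : Fin q → Bool
  ψ j = colour (offset q (toℕ j) (toℕ i) <ᵇ t) =F opp c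
  ψMy≡false : ψ (M y) ≡ false
  ψMy≡false = trans (cong (_=F opp c) Gy≡c) (opp-differs c)
  ∑below : ∑[ j < q ] 𝟙 (offset q (toℕ j) (toℕ i) <ᵇ t) ≡ t
  ∑below = ∑-below q (λ j → offset q (toℕ j) (toℕ i)) (λ u u<q → offsets-to q (toℕ i) u (toℕ<n i) u<q) t t≤q

∑-positive : ∀ n (P : Fin n → Bool) → 0 < ∑[ i < n ] 𝟙 (P i) → ∃ λ i → P i ≡ true
∑-positive (suc n) P pos with P 0F in P0
... | true = 0F , P0
... | false with ∑-positive n (λ i → P (Fin.suc i)) pos
...   | i , Pi = Fin.suc i , Pi

G-occurs : ∀ q m (M : Vertex q m → Fin q) t → t ≤ q → ∀ y c → 0 < classSize q t c → ∃ λ i → G q m M i t y ≡ c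
G-occurs q m M t t≤q y c pos with ∑-positive q (λ i → G q m M i t y =F c) (subst (0 <_) (sym (G-fibre q m M t t≤q y c)) pos)
... | i , Gy=c = i , =F-sound Gy=c

data Block (a b : ℕ) : Fin (a + b) → Set where
  first : ∀ i → Block a b (i ↑ˡ b)
  second : ∀ i → Block a b (a ↑ʳ i)

block : ∀ a b j → Block a b j
block a b j with splitAt a j in e
... | inj₁ i = subst (Block a b) (splitAt⁻¹-↑ˡ e) (first i)
... | inj₂ i = subst (Block a b) (splitAt⁻¹-↑ʳ e) (second i)

∑-G : ∀ q m (M : Vertex q m → Fin q) t → t ≤ q → ∀ A y c →
      ∑[ i < q ] (A * 𝟙 (G q m M i t y =F c)) ≡ A * classSize q t c
∑-G q m M t t≤q A y c = trans (sym (*-distribˡ-sum {q} A _)) (cong (A *_) (G-fibre q m M t t≤q y c))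

-- The fibre count m T combines with the weight α of the own block when γ = α + m.
absorb : ∀ {α γ m} → γ ≡ α + m → ∀ T B → m * T + (α * T + B) ≡ γ * T + B
absorb {α} {γ} {m} refl T B =
  trans (sym (+-assoc (m * T) (α * T) B)) (cong (_+ B) (trans (sym (*-distribʳ-+ T m α)) (cong (_* T) (+-comm m α))))

const-nbrCount : ∀ q m (l c : Fin 2) → (l =F c) ≡ false → ∀ y → nbrCount {q} {m} (λ _ → l) y c ≡ 0
const-nbrCount q m l c l≠c y = trans (nbrCount≡nbrs (λ _ → l) y c) (trans (ΣV-cong q m never) (ΣV-zero q m))
  where
  never : ∀ y' → 𝟙 ((ham y y' ≡ᵇ 1) ∧ (l =F c)) ≡ 0
  never y' rewrite l≠c with ham y y' ≡ᵇ 1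
  ... | true = refl
  ... | false = refl

𝟙-is-colour₂ : ∀ (l : Fin 2) → 𝟙 (l =F 1F) ≡ toℕ l
𝟙-is-colour₂ 0F = refl
𝟙-is-colour₂ 1F = refl

𝟙-is-colour₁ : ∀ (l : Fin 2) → 𝟙 (l =F 0F) ≡ 1 ∸ toℕ l
𝟙-is-colour₁ 0F = refl
𝟙-is-colour₁ 1F = refl

someVertex : ∀ {q} m → 0 < q → Vertex q m
someVertex m q>0 = replicate m (fromℕ< q>0)

-- The non-degeneracy condition of part (1): the colour other than l has a nonempty class.
other-class-nonempty : ∀ q t (l c : Fin 2) → t * toℕ l + (q ∸ t) * (1 ∸ toℕ l) ≢ 0 → l ≢ c → 0 < classSize q t c
other-class-nonempty q t 0F 0F _ l≢c = ⊥-elim (l≢c refl)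
other-class-nonempty q t 0F 1F nondegenerate _ =
  n≢0⇒n>0 (λ q∸t≡0 → nondegenerate (trans (cong₂ _+_ (*-zeroʳ t) (*-identityʳ (q ∸ t))) q∸t≡0))
other-class-nonempty q t 1F 0F nondegenerate _ =
  n≢0⇒n>0 (λ t≡0 → nondegenerate (trans (cong₂ _+_ (*-identityʳ t) (*-zeroʳ (q ∸ t))) (trans (+-identityʳ t) t≡0)))
other-class-nonempty q t 1F 1F _ l≢c = ⊥-elim (l≢c refl)

module Part1 (q m : ℕ) (M : Vertex q m → Fin q) (t : ℕ) (l : Fin 2) (α' α β γ δ : ℕ) where

  g : Fin (q + 1) → Vertex q m → Fin 2
  g = g1 q m M t l

  S : Fin (q + 1) → Fin (q + 1) → ℕ
  S = S1 q α' α β γ δ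

  g-first : ∀ i y → g (i ↑ˡ 1) y ≡ G q m M i t y
  g-first i y rewrite splitAt-↑ˡ q i 1 = refl

  g-second : ∀ k y → g (q ↑ʳ k) y ≡ l
  g-second k y rewrite splitAt-↑ʳ q 1 k = refl

  S-first-first : ∀ i i' → S (i ↑ˡ 1) (i' ↑ˡ 1) ≡ (if i =F i' then α' else α)
  S-first-first i i' rewrite splitAt-↑ˡ q i 1 | splitAt-↑ˡ q i' 1 = refl

  S-first-second : ∀ i k → S (i ↑ˡ 1) (q ↑ʳ k) ≡ β
  S-first-second i k rewrite splitAt-↑ˡ q i 1 | splitAt-↑ʳ q 1 k = refl

  S-second-first : ∀ k i → S (q ↑ʳ k) (i ↑ˡ 1) ≡ γ
  S-second-first k i rewrite splitAt-↑ʳ q 1 k | splitAt-↑ˡ q i 1 = refl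

  S-second-second : ∀ k k' → S (q ↑ʳ k) (q ↑ʳ k') ≡ δ
  S-second-second k k' rewrite splitAt-↑ʳ q 1 k | splitAt-↑ʳ q 1 k' = refl

  -- The other-colour count of a vertex of colour c in the invasion.
  D : Fin 2 → ℕ
  D c = γ * classSize q t (opp c) + β * 𝟙 (l =F opp c)

  -- Row i ≤ q of S against the colours of g at y; the diagonal entry α' does not contribute
  -- because G^i_t(y) = c is not the colour counted.
  row-first : t ≤ q → ∀ i y c → G q m M i t y ≡ c →
              ∑[ j < q + 1 ] (S (i ↑ˡ 1) j * 𝟙 (g j y =F opp c)) ≡ α * classSize q t (opp c) + β * 𝟙 (l =F opp c)
  row-first t≤q i y c Gy≡c =
    trans (∑-split q 1 _)
          (cong₂ _+_ (trans (sum-cong-≗ off-diagonal) (∑-G q m M t t≤q α y (opp c)))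
                     (trans (+-identityʳ _) (cong₂ _*_ (S-first-second i 0F) (cong (λ b → 𝟙 (b =F opp c)) (g-second 0F y)))))
    where
    off-diagonal : ∀ i' → S (i ↑ˡ 1) (i' ↑ˡ 1) * 𝟙 (g (i' ↑ˡ 1) y =F opp c) ≡ α * 𝟙 (G q m M i' t y =F opp c)
    off-diagonal i' rewrite S-first-first i i' | g-first i' y with i =F i' in i≡i'
    ... | false = refl
    ... | true = *-zero-weights α' α (cong 𝟙 (trans (cong (λ k → G q m M k t y =F opp c) (sym (=F-sound i≡i')))
                                                   (trans (cong (_=F opp c) Gy≡c) (opp-differs c))))

  row-second : t ≤ q → ∀ y c →
               ∑[ j < q + 1 ] (S (q ↑ʳ 0F) j * 𝟙 (g j y =F opp c)) ≡ γ * classSize q t (opp c) + δ * 𝟙 (l =F opp c)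
  row-second t≤q y c =
    trans (∑-split q 1 _)
          (cong₂ _+_ (trans (sum-cong-≗ (λ i → cong₂ _*_ (S-second-first 0F i) (cong (λ b → 𝟙 (b =F opp c)) (g-first i y))))
                            (∑-G q m M t t≤q γ y (opp c)))
                     (trans (+-identityʳ _) (cong₂ _*_ (S-second-second 0F 0F) (cong (λ b → 𝟙 (b =F opp c)) (g-second 0F y)))))

  local : (1 ≤ m → Proper M) → t ≤ q → γ ≡ α + m → ∀ j y c → g j y ≡ c →
          nbrCount (g j) y (opp c) + ∑[ j' < q + 1 ] (S j j' * 𝟙 (g j' y =F opp c)) ≡ D c
  local proper t≤q γ≡α+m j y c gjy≡c with block q 1 j
  ... | first i =
    trans (cong₂ _+_ (trans (nbrCount-cong (g-first i) y (opp c)) (G-nbrCount q m M proper i t t≤q y c Giy≡c))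
                     (row-first t≤q i y c Giy≡c))
          (absorb {α} {γ} {m} γ≡α+m (classSize q t (opp c)) _)
    where
    Giy≡c : G q m M i t y ≡ c
    Giy≡c = trans (sym (g-first i y)) gjy≡c
  ... | second 0F =
    trans (cong₂ _+_ (trans (nbrCount-cong (g-second 0F) y (opp c)) (const-nbrCount q m l (opp c) l≠opp-c y))
                     (row-second t≤q y c))
          (cong (γ * classSize q t (opp c) +_) (*-zero-weights δ β (cong 𝟙 l≠opp-c)))
    where
    l≠opp-c : (l =F opp c) ≡ false
    l≠opp-c = trans (cong (_=F opp c) (trans (sym (g-second 0F y)) gjy≡c)) (opp-differs c)

  -- Every colour occurs: colour l in the second block, the other one in some G^i_t.
  occurs : 0 < q → t ≤ q → t * toℕ l + (q ∸ t) * (1 ∸ toℕ l) ≢ 0 → ∀ c → ∃₂ λ j y → g j y ≡ c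
  occurs q>0 t≤q nondegenerate c with l Fin.≟ c
  ... | yes l≡c = q ↑ʳ 0F , someVertex m q>0 , trans (g-second 0F _) l≡c
  ... | no l≢c with G-occurs q m M t t≤q (someVertex m q>0) c (other-class-nonempty q t l c nondegenerate l≢c)
  ...   | i , Giy≡c = i ↑ˡ 1 , someVertex m q>0 , trans (g-first i _) Giy≡c

  invasion-is-bc : ∀ {n} (f : Vertex q n → Fin (q + 1)) → IsPerfectColoring f S → (1 ≤ m → Proper M) → 0 < q →
    γ ≡ α + m → t ≤ q → t * toℕ l + (q ∸ t) * (1 ∸ toℕ l) ≢ 0 →
    IsBCColoring {q} {n + m} (γ * (q ∸ t) + β * toℕ l) (γ * t + β * (1 ∸ toℕ l)) (invasion f g)
  invasion-is-bc f perfect proper q>0 γ≡α+m t≤q nondegenerate =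
    subst₂ (λ b c → IsBCColoring b c (invasion f g))
           (cong (λ k → γ * (q ∸ t) + β * k) (𝟙-is-colour₂ l)) (cong (λ k → γ * t + β * k) (𝟙-is-colour₁ l))
           (invasion-bc f S g D perfect (occurs q>0 t≤q nondegenerate) (local proper t≤q γ≡α+m))

some-class-nonempty : ∀ q t₁ t₂ → t₁ ≤ q → t₂ ≤ q → t₁ + t₂ ≢ 0 → t₁ + t₂ ≢ q + q →
                      ∀ c → 0 < classSize q t₁ c ⊎ 0 < classSize q t₂ c
some-class-nonempty q t₁ t₂ t₁≤q t₂≤q ≢0 ≢2q 0F with t₁ ≟ 0
... | no t₁≢0 = inj₁ (n≢0⇒n>0 t₁≢0)
... | yes t₁≡0 = inj₂ (n≢0⇒n>0 (λ t₂≡0 → ≢0 (cong₂ _+_ t₁≡0 t₂≡0)))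
some-class-nonempty q t₁ t₂ t₁≤q t₂≤q ≢0 ≢2q 1F with t₁ <? q
... | yes t₁<q = inj₁ (m<n⇒0<n∸m t₁<q)
... | no t₁≮q = inj₂ (m<n⇒0<n∸m (≤∧≢⇒< t₂≤q (λ t₂≡q → ≢2q (cong₂ _+_ (≤-antisym t₁≤q (≮⇒≥ t₁≮q)) t₂≡q))))

-- The fibre count m T₂ combines with the weight δ of the second block when β = δ + m.
absorb-second : ∀ {δ β m} → β ≡ δ + m → ∀ T A → m * T + (A + δ * T) ≡ A + β * T
absorb-second {δ} {β} {m} β≡δ+m T A =
  trans (cong (m * T +_) (+-comm A (δ * T))) (trans (absorb {δ} {β} {m} β≡δ+m T A) (+-comm (β * T) A))

complement-weights : ∀ q t₁ t₂ γ β → t₁ ≤ q → t₂ ≤ q → γ * (q ∸ t₁) + β * (q ∸ t₂) ≡ q * (γ + β) ∸ γ * t₁ ∸ β * t₂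
complement-weights q t₁ t₂ γ β t₁≤q t₂≤q = sym (begin
    q * (γ + β) ∸ γ * t₁ ∸ β * t₂
  ≡⟨ cong (λ w → w ∸ γ * t₁ ∸ β * t₂) (trans (*-distribˡ-+ q γ β) (cong₂ _+_ (*-comm q γ) (*-comm q β))) ⟩
    γ * q + β * q ∸ γ * t₁ ∸ β * t₂
  ≡⟨ cong (_∸ β * t₂) (+-∸-comm (β * q) (*-monoʳ-≤ γ t₁≤q)) ⟩
    (γ * q ∸ γ * t₁) + β * q ∸ β * t₂
  ≡⟨ +-∸-assoc (γ * q ∸ γ * t₁) (*-monoʳ-≤ β t₂≤q) ⟩
    (γ * q ∸ γ * t₁) + (β * q ∸ β * t₂)
  ≡⟨ sym (cong₂ _+_ (*-distribˡ-∸ γ q t₁) (*-distribˡ-∸ β q t₂)) ⟩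
    γ * (q ∸ t₁) + β * (q ∸ t₂)
  ∎)
  where open ≡-Reasoning

module Part2 (q m : ℕ) (M : Vertex q m → Fin q) (t₁ t₂ : ℕ) (α β γ δ : ℕ) where

  g : Fin (q + q) → Vertex q m → Fin 2
  g = g2 q m M t₁ t₂

  S : Fin (q + q) → Fin (q + q) → ℕ
  S = S2 q α β γ δ

  g-first : ∀ i y → g (i ↑ˡ q) y ≡ G q m M i t₁ y
  g-first i y rewrite splitAt-↑ˡ q i q = refl

  g-second : ∀ i y → g (q ↑ʳ i) y ≡ G q m M i t₂ y
  g-second i y rewrite splitAt-↑ʳ q q i = refl

  S-first-first : ∀ i i' → S (i ↑ˡ q) (i' ↑ˡ q) ≡ α
  S-first-first i i' rewrite splitAt-↑ˡ q i q | splitAt-↑ˡ q i' q = refl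

  S-first-second : ∀ i i' → S (i ↑ˡ q) (q ↑ʳ i') ≡ β
  S-first-second i i' rewrite splitAt-↑ˡ q i q | splitAt-↑ʳ q q i' = refl

  S-second-first : ∀ i i' → S (q ↑ʳ i) (i' ↑ˡ q) ≡ γ
  S-second-first i i' rewrite splitAt-↑ʳ q q i | splitAt-↑ˡ q i' q = refl

  S-second-second : ∀ i i' → S (q ↑ʳ i) (q ↑ʳ i') ≡ δ
  S-second-second i i' rewrite splitAt-↑ʳ q q i | splitAt-↑ʳ q q i' = refl

  -- The other-colour count of a vertex of colour c in the invasion.
  D : Fin 2 → ℕ
  D c = γ * classSize q t₁ (opp c) + β * classSize q t₂ (opp c)

  row : t₁ ≤ q → t₂ ≤ q → ∀ j A B → (∀ i → S j (i ↑ˡ q) ≡ A) → (∀ i → S j (q ↑ʳ i) ≡ B) → ∀ y c →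
        ∑[ j' < q + q ] (S j j' * 𝟙 (g j' y =F c)) ≡ A * classSize q t₁ c + B * classSize q t₂ c
  row t₁≤q t₂≤q j A B S≡A S≡B y c =
    trans (∑-split q q _)
          (cong₂ _+_ (trans (sum-cong-≗ (λ i → cong₂ _*_ (S≡A i) (cong (λ b → 𝟙 (b =F c)) (g-first i y)))) (∑-G q m M t₁ t₁≤q A y c))
                     (trans (sum-cong-≗ (λ i → cong₂ _*_ (S≡B i) (cong (λ b → 𝟙 (b =F c)) (g-second i y)))) (∑-G q m M t₂ t₂≤q B y c)))

  local : (1 ≤ m → Proper M) → t₁ ≤ q → t₂ ≤ q → γ ≡ α + m → β ≡ δ + m → ∀ j y c → g j y ≡ c →
          nbrCount (g j) y (opp c) + ∑[ j' < q + q ] (S j j' * 𝟙 (g j' y =F opp c)) ≡ D c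
  local proper t₁≤q t₂≤q γ≡α+m β≡δ+m j y c gjy≡c with block q q j
  ... | first i =
    trans (cong₂ _+_ (trans (nbrCount-cong (g-first i) y (opp c))
                            (G-nbrCount q m M proper i t₁ t₁≤q y c (trans (sym (g-first i y)) gjy≡c)))
                     (row t₁≤q t₂≤q (i ↑ˡ q) α β (S-first-first i) (S-first-second i) y (opp c)))
          (absorb {α} {γ} {m} γ≡α+m (classSize q t₁ (opp c)) _)
  ... | second i =
    trans (cong₂ _+_ (trans (nbrCount-cong (g-second i) y (opp c))
                            (G-nbrCount q m M proper i t₂ t₂≤q y c (trans (sym (g-second i y)) gjy≡c)))
                     (row t₁≤q t₂≤q (q ↑ʳ i) γ δ (S-second-first i) (S-second-second i) y (opp c)))
          (absorb-second {δ} {β} {m} β≡δ+m (classSize q t₂ (opp c)) _)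

  occurs : 0 < q → t₁ ≤ q → t₂ ≤ q → t₁ + t₂ ≢ 0 → t₁ + t₂ ≢ q + q → ∀ c → ∃₂ λ j y → g j y ≡ c
  occurs q>0 t₁≤q t₂≤q ≢0 ≢2q c with some-class-nonempty q t₁ t₂ t₁≤q t₂≤q ≢0 ≢2q c
  ... | inj₁ nonempty with G-occurs q m M t₁ t₁≤q (someVertex m q>0) c nonempty
  ...   | i , Giy≡c = i ↑ˡ q , someVertex m q>0 , trans (g-first i _) Giy≡c
  occurs q>0 t₁≤q t₂≤q ≢0 ≢2q c | inj₂ nonempty with G-occurs q m M t₂ t₂≤q (someVertex m q>0) c nonempty
  ...   | i , Giy≡c = q ↑ʳ i , someVertex m q>0 , trans (g-second i _) Giy≡c

  invasion-is-bc : ∀ {n} (f : Vertex q n → Fin (q + q)) → IsPerfectColoring f S → (1 ≤ m → Proper M) → 0 < q →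
    γ ≡ α + m → β ≡ δ + m → t₁ ≤ q → t₂ ≤ q → t₁ + t₂ ≢ 0 → t₁ + t₂ ≢ q + q →
    IsBCColoring {q} {n + m} (q * (γ + β) ∸ γ * t₁ ∸ β * t₂) (γ * t₁ + β * t₂) (invasion f g)
  invasion-is-bc f perfect proper q>0 γ≡α+m β≡δ+m t₁≤q t₂≤q ≢0 ≢2q =
    subst (λ b → IsBCColoring b (γ * t₁ + β * t₂) (invasion f g)) (complement-weights q t₁ t₂ γ β t₁≤q t₂≤q)
          (invasion-bc f S g D perfect (occurs q>0 t₁≤q t₂≤q ≢0 ≢2q) (local proper t₁≤q t₂≤q γ≡α+m β≡δ+m))

proposition9 : (n q m : ℕ) → 1 ≤ n → 2 ≤ q
    → (M : Vertex q m → Fin q) → (1 ≤ m → IsMDSPartition q m M)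
    → ((f : Vertex q n → Fin (q + 1)) (α' α β γ δ : ℕ)
        → IsPerfectColoring f (S1 q α' α β γ δ)
        → γ ≡ α + m
        → (t : ℕ) → t ≤ q → (l : Fin 2)
        → t * toℕ l + (q ∸ t) * (1 ∸ toℕ l) ≢ 0
        → IsBCColoring {q} {n + m}
            (γ * (q ∸ t) + β * toℕ l) (γ * t + β * (1 ∸ toℕ l))
            (invasion f (g1 q m M t l)))
    × ((f : Vertex q n → Fin (q + q)) (α β γ δ : ℕ)
        → IsPerfectColoring f (S2 q α β γ δ)
        → γ ≡ α + m → β ≡ δ + m
        → (t₁ t₂ : ℕ) → t₁ ≤ q → t₂ ≤ q
        → t₁ + t₂ ≢ 0 → t₁ + t₂ ≢ q + q
        → IsBCColoring {q} {n + m}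
            (q * (γ + β) ∸ γ * t₁ ∸ β * t₂) (γ * t₁ + β * t₂)
            (invasion f (g2 q m M t₁ t₂)))
proposition9 n q m _ 2≤q M mds =
  (λ f α' α β γ δ perfect γ≡α+m t t≤q l nondegenerate →
     Part1.invasion-is-bc q m M t l α' α β γ δ f perfect proper q>0 γ≡α+m t≤q nondegenerate) ,
  (λ f α β γ δ perfect γ≡α+m β≡δ+m t₁ t₂ t₁≤q t₂≤q ≢0 ≢2q →
     Part2.invasion-is-bc q m M t₁ t₂ α β γ δ f perfect proper q>0 γ≡α+m β≡δ+m t₁≤q t₂≤q ≢0 ≢2q)
  where
  q>0 : 0 < q
  q>0 = ≤-trans (s≤s z≤n) 2≤q
  proper : 1 ≤ m → Proper M
  proper 1≤m = mds-partition-proper q m M (mds 1≤m)
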